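{- Let $H=(V,E)$ be a graph and let $F$ be a vector space of dimension $r$ over $\mathbb{Z}_2$. Assign to each edge $e\in E$ a vector $v(e)\in F$. Suppose that for every cut $(S,V\setminus S)=\{e\in E: e\cap S\neq\emptyset,\ e\cap(V\setminus S)\neq\emptyset\}$, where $\emptyset\neq S\subsetneq V$, the set of vectors $\{v(e): e\in (S,V\setminus S)\}$ spans $F$. Then $m(H)\ge 2^r$.
   Context: All graphs are finite and simple. The symmetric difference of two graphs $G_1=(V,E_1)$, $G_2=(V,E_2)$ on the same vertex set is the graph $(V,E_1\oplus E_2)$, where $E_1\oplus E_2$ is the set of edges belonging to exactly one of $E_1,E_2$. For a graph $H$, a connectivity code for $H$ is a collection $\mathcal G$ of spanning subgraphs of $H$ such that the symmetric difference of any two distinct members of $\mathcal G$ is a connected spanning subgraph of $H$. $m(H)$ denotes the maximum possible cardinality of a connectivity code for $H$. -}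

module Defs where

open import Data.Nat using (ℕ; _^_)
open import Data.Bool using (Bool; true; false; _xor_)
open import Data.Fin using (Fin)
open import Data.Vec using (Vec; replicate; zipWith)
open import Data.Product using (Σ; ∃; _×_; _,_)
open import Relation.Binary.PropositionalEquality using (_≡_; _≢_)
open import Relation.Nullary using (¬_)

record Graph (n : ℕ) : Set where
  field
    adj    : Fin n → Fin n → Bool
    sym    : ∀ a b → adj a b ≡ adj b a
    irrefl : ∀ a → adj a a ≡ false
open Graph public

record SpanningSubgraph {n : ℕ} (H : Graph n) : Set where
  field
    edge  : Fin n → Fin n → Bool
    esym  : ∀ a b → edge a b ≡ edge b a
    inH   : ∀ a b → edge a b ≡ true → adj H a b ≡ true
open SpanningSubgraph public

symDiff : {n : ℕ} {H : Graph n} → SpanningSubgraph H → SpanningSubgraph H →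
          Fin n → Fin n → Bool
symDiff G₁ G₂ a b = edge G₁ a b xor edge G₂ a b

data Walk {n : ℕ} (E : Fin n → Fin n → Bool) : Fin n → Fin n → Set where
  here : ∀ {a} → Walk E a a
  step : ∀ {a c b} → E a c ≡ true → Walk E c b → Walk E a b

Connected : {n : ℕ} → (Fin n → Fin n → Bool) → Set
Connected {n} E = ∀ (a b : Fin n) → Walk E a b

SameSubgraph : {n : ℕ} {H : Graph n} → SpanningSubgraph H → SpanningSubgraph H → Set
SameSubgraph {n} G₁ G₂ = ∀ (a b : Fin n) → edge G₁ a b ≡ edge G₂ a b

ConnectivityCode : {n : ℕ} (H : Graph n) (k : ℕ) → (Fin k → SpanningSubgraph H) → Set
ConnectivityCode H k G =
  ∀ (i j : Fin k) → i ≢ j →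
    (¬ SameSubgraph (G i) (G j)) × Connected (symDiff (G i) (G j))

-- m(H) ≥ k : there is a connectivity code with (at least, equivalently exactly) k members.
mAtLeast : {n : ℕ} (H : Graph n) (k : ℕ) → Set
mAtLeast H k = Σ (Fin k → SpanningSubgraph H) (ConnectivityCode H k)

-- The vector space F = Z₂^r (every r-dimensional Z₂-space is isomorphic to it).
Z2Vec : ℕ → Set
Z2Vec r = Vec Bool r

_⊕_ : {r : ℕ} → Z2Vec r → Z2Vec r → Z2Vec r
_⊕_ = zipWith _xor_

zeroVec : {r : ℕ} → Z2Vec r
zeroVec = replicate _ false

data InSpan {r : ℕ} (P : Z2Vec r → Set) : Z2Vec r → Set where
  span-zero : InSpan P zeroVec
  span-add  : ∀ {u w} → P u → InSpan P w → InSpan P (u ⊕ w)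

Spans : {r : ℕ} → (Z2Vec r → Set) → Set
Spans {r} P = ∀ (w : Z2Vec r) → InSpan P w

ProperNonempty : {n : ℕ} → (Fin n → Bool) → Set
ProperNonempty S = (∃ λ a → S a ≡ true) × (∃ λ b → S b ≡ false)

CutVector : {n r : ℕ} (H : Graph n) (v : Fin n → Fin n → Z2Vec r) →
            (Fin n → Bool) → Z2Vec r → Set
CutVector H v S u =
  ∃ λ a → ∃ λ b → adj H a b ≡ true × S a ≡ true × S b ≡ false × u ≡ v a b

{-# OPTIONS --safe #-}
module Submission where

-- Index the code by w ∈ Z₂^r and let G_w consist of the edges e with ⟨w, v(e)⟩ = 1.
-- For x ≠ y the symmetric difference of G_x and G_y consists of the edges on which the
-- nonzero functional ⟨x + y, ·⟩ takes the value 1. Since the vectors of every cut span F,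
-- this functional is 1 on some edge of every cut, so every cut is crossed by the symmetric
-- difference, which is therefore connected (and, as n ≥ 2, nonempty, so G_x ≠ G_y).

open import Defs hiding (sym)
open import Algebra.Bundles using (CommutativeRing)
open import Data.Bool using (Bool; true; false; _∧_; _xor_; _≟_)
open import Data.Bool.Properties
  using (∧-zeroʳ; ∧-identityʳ; ∧-distribˡ-xor; xor-identityʳ; xor-same; xor-∧-commutativeRing)
open import Data.Fin using (Fin; zero; suc; combine; finToFun; funToFin)
open import Data.Fin.Properties using (funToFin-finToFin)
open import Data.Fin.Subset using (Subset; _∈_; _∉_; _∪_; ⁅_⁆; ∣_∣)
open import Data.Fin.Subset.Properties
  using (_∈?_; ∈⊤; x∈⁅x⁆; x∈⁅y⁆⇒x≡y; p⊆p∪q; x∈p∪q⁺; x∈p∪q⁻; ∣p∣≤n; ∣p∣≡n⇒p≡⊤; p⊂q⇒∣p∣<∣q∣)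
open import Data.Nat using (ℕ; zero; suc; _+_; _≤_; _<_; _^_; s≤s)
open import Data.Nat.Properties using (≤-antisym; m≤m+n; +-suc; +-monoʳ-≤; module ≤-Reasoning)
open import Data.Product using (∃; ∃₂; _×_; _,_)
open import Data.Sum using (inj₁; inj₂)
open import Data.Vec using ([]; _∷_; lookup; tabulate)
open import Data.Vec.Properties using ([]=⇒lookup; lookup⇒[]=; lookup∘tabulate)
open import Function using (_∘_)
open import Relation.Binary.PropositionalEquality
  using (_≡_; _≢_; _≗_; refl; sym; trans; cong; cong₂; subst; module ≡-Reasoning)
open import Relation.Nullary using (¬_; yes; no; contradiction)

open import Algebra.Properties.CommutativeSemigroup
  (CommutativeRing.+-commutativeSemigroup xor-∧-commutativeRing)
  using () renaming (interchange to xor-interchange)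

∧-true⇒left : ∀ {x y} → x ∧ y ≡ true → x ≡ true
∧-true⇒left {true} _ = refl

≢⇒xor≡true : ∀ {x y} → x ≢ y → x xor y ≡ true
≢⇒xor≡true {false} {false} x≢y = contradiction refl x≢y
≢⇒xor≡true {false} {true}  _   = refl
≢⇒xor≡true {true}  {false} _   = refl
≢⇒xor≡true {true}  {true}  x≢y = contradiction refl x≢y

record IsLinear {r : ℕ} (φ : Z2Vec r → Bool) : Set where
  field
    zero-homo : φ zeroVec ≡ false
    ⊕-homo    : ∀ u w → φ (u ⊕ w) ≡ φ u xor φ w

open IsLinear

xor-linear : ∀ {r} {φ ψ : Z2Vec r → Bool} → IsLinear φ → IsLinear ψ →
             IsLinear (λ u → φ u xor ψ u)
xor-linear {φ = φ} {ψ} φ-lin ψ-lin = record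
  { zero-homo = cong₂ _xor_ (zero-homo φ-lin) (zero-homo ψ-lin)
  ; ⊕-homo    = λ u w → trans (cong₂ _xor_ (⊕-homo φ-lin u w) (⊕-homo ψ-lin u w))
                              (xor-interchange (φ u) (φ w) (ψ u) (ψ w))
  }

span-nonzero⇒generator-nonzero : ∀ {r} {P : Z2Vec r → Set} {φ : Z2Vec r → Bool} → IsLinear φ →
                 ∀ {u} → InSpan P u → φ u ≡ true → ∃ λ p → P p × φ p ≡ true
span-nonzero⇒generator-nonzero φ-lin span-zero φ0≡true =
  contradiction (trans (sym (zero-homo φ-lin)) φ0≡true) λ ()
span-nonzero⇒generator-nonzero {φ = φ} φ-lin (span-add {p} {w} Pp w∈span) φ[p⊕w]≡true with φ p in φp
... | true  = p , Pp , φp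
... | false = span-nonzero⇒generator-nonzero φ-lin w∈span (begin
  φ w               ≡⟨⟩
  false xor φ w     ≡⟨ cong (_xor φ w) φp ⟨
  φ p xor φ w       ≡⟨ ⊕-homo φ-lin p w ⟨
  φ (p ⊕ w)         ≡⟨ φ[p⊕w]≡true ⟩
  true              ∎)
  where open ≡-Reasoning

dot : ∀ {r} → Z2Vec r → Z2Vec r → Bool
dot []       []       = false
dot (x ∷ xs) (y ∷ ys) = (x ∧ y) xor dot xs ys

dot-zeroʳ : ∀ {r} (w : Z2Vec r) → dot w zeroVec ≡ false
dot-zeroʳ []      = refl
dot-zeroʳ (x ∷ w) rewrite ∧-zeroʳ x = dot-zeroʳ w

dot-⊕ʳ : ∀ {r} (w u u′ : Z2Vec r) → dot w (u ⊕ u′) ≡ dot w u xor dot w u′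
dot-⊕ʳ []      []      []        = refl
dot-⊕ʳ (x ∷ w) (y ∷ u) (y′ ∷ u′) = begin
  (x ∧ (y xor y′)) xor dot w (u ⊕ u′)
    ≡⟨ cong₂ _xor_ (∧-distribˡ-xor x y y′) (dot-⊕ʳ w u u′) ⟩
  ((x ∧ y) xor (x ∧ y′)) xor (dot w u xor dot w u′)
    ≡⟨ xor-interchange (x ∧ y) (x ∧ y′) (dot w u) (dot w u′) ⟩
  ((x ∧ y) xor dot w u) xor ((x ∧ y′) xor dot w u′)
    ∎
  where open ≡-Reasoning

dot-linear : ∀ {r} (w : Z2Vec r) → IsLinear (dot w)
dot-linear w = record { zero-homo = dot-zeroʳ w ; ⊕-homo = dot-⊕ʳ w }

dot-separates : ∀ {r} {x y : Z2Vec r} → x ≢ y → ∃ λ u → dot x u ≢ dot y u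
dot-separates {x = []} {[]} []≢[] = contradiction refl []≢[]
dot-separates {x = a ∷ x} {b ∷ y} ax≢by with a ≟ b
... | no a≢b = true ∷ zeroVec , λ eq → a≢b (begin
  a                            ≡⟨ first-coordinate a x ⟨
  (a ∧ true) xor dot x zeroVec ≡⟨ eq ⟩
  (b ∧ true) xor dot y zeroVec ≡⟨ first-coordinate b y ⟩
  b                            ∎)
  where
  open ≡-Reasoning
  first-coordinate : ∀ c (z : Z2Vec _) → (c ∧ true) xor dot z zeroVec ≡ c
  first-coordinate c z rewrite dot-zeroʳ z | ∧-identityʳ c = xor-identityʳ c
... | yes refl with dot-separates (ax≢by ∘ cong (a ∷_))
...   | u , x·u≢y·u = false ∷ u , λ eq → x·u≢y·u (begin
  dot x u                 ≡⟨⟩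
  false xor dot x u       ≡⟨ cong (_xor dot x u) (∧-zeroʳ a) ⟨
  (a ∧ false) xor dot x u ≡⟨ eq ⟩
  (a ∧ false) xor dot y u ≡⟨ cong (_xor dot y u) (∧-zeroʳ a) ⟩
  dot y u                 ∎)
  where open ≡-Reasoning

bit : Fin 2 → Bool
bit zero       = false
bit (suc zero) = true

bit-injective : ∀ {i j} → bit i ≡ bit j → i ≡ j
bit-injective {zero}     {zero}     _ = refl
bit-injective {zero}     {suc zero} ()
bit-injective {suc zero} {zero}     ()
bit-injective {suc zero} {suc zero} _ = refl

funToFin-cong : ∀ {m n} {f g : Fin m → Fin n} → f ≗ g → funToFin f ≡ funToFin g
funToFin-cong {zero} _   = refl
funToFin-cong {suc m} f≗g = cong₂ combine (f≗g zero) (funToFin-cong (f≗g ∘ suc))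

digits : ∀ r → Fin (2 ^ r) → Fin r → Fin 2
digits r = finToFun

bits : ∀ r → Fin (2 ^ r) → Z2Vec r
bits r i = tabulate (bit ∘ digits r i)

bits-injective : ∀ r {i j} → bits r i ≡ bits r j → i ≡ j
bits-injective r {i} {j} eq = begin
  i                     ≡⟨ funToFin-finToFin {r} i ⟨
  funToFin (digits r i) ≡⟨ funToFin-cong digits-equal ⟩
  funToFin (digits r j) ≡⟨ funToFin-finToFin {r} j ⟩
  j                     ∎
  where
  open ≡-Reasoning
  digits-equal : digits r i ≗ digits r j
  digits-equal k = bit-injective (begin
    bit (digits r i k)  ≡⟨ lookup∘tabulate (bit ∘ digits r i) k ⟨
    lookup (bits r i) k ≡⟨ cong (λ w → lookup w k) eq ⟩
    lookup (bits r j) k ≡⟨ lookup∘tabulate (bit ∘ digits r j) k ⟩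
    bit (digits r j k)  ∎)

CrossesEveryCut : ∀ {n} → (Fin n → Fin n → Bool) → Set
CrossesEveryCut {n} E = ∀ (S : Fin n → Bool) → ProperNonempty S →
  ∃₂ λ x y → S x ≡ true × S y ≡ false × E x y ≡ true

walk-snoc : ∀ {n} {E : Fin n → Fin n → Bool} {a x y} → Walk E a x → E x y ≡ true → Walk E a y
walk-snoc here         Exy = step Exy here
walk-snoc (step Eac w) Exy = step Eac (walk-snoc w Exy)

lookup-∉ : ∀ {n} {x : Fin n} {p : Subset n} → x ∉ p → lookup p x ≡ false
lookup-∉ {x = x} {p} x∉p with lookup p x in eq
... | true  = contradiction (lookup⇒[]= x p eq) x∉p
... | false = refl

ReachedFrom : ∀ {n} → (Fin n → Fin n → Bool) → Fin n → Subset n → Set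
ReachedFrom E a R = ∀ {x} → x ∈ R → Walk E a x

module _ {n} {E : Fin n → Fin n → Bool} (a : Fin n) (crosses : CrossesEveryCut E) where

  reach-one-more : ∀ {R b} → a ∈ R → b ∉ R → ReachedFrom E a R →
                   ∃ λ y → y ∉ R × ReachedFrom E a (R ∪ ⁅ y ⁆)
  reach-one-more {R} {b} a∈R b∉R walks
    with crosses (lookup R) ((a , []=⇒lookup a∈R) , (b , lookup-∉ b∉R))
  ... | x , y , x∈R , y∉R , Exy = y , y∉R′ , walks′
    where
    y∉R′ : y ∉ R
    y∉R′ y∈R = contradiction (trans (sym ([]=⇒lookup y∈R)) y∉R) λ ()
    walks′ : ReachedFrom E a (R ∪ ⁅ y ⁆)
    walks′ {z} z∈R′ with x∈p∪q⁻ R ⁅ y ⁆ z∈R′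
    ... | inj₁ z∈R = walks z∈R
    ... | inj₂ z∈⁅y⁆ with x∈⁅y⁆⇒x≡y y z∈⁅y⁆
    ...   | refl = walk-snoc (walks (lookup⇒[]= x R x∈R)) Exy

  -- Each step enlarges R, and fuel + ∣ R ∣ ≥ n bounds the number of steps.
  reach-all : ∀ fuel R → n ≤ fuel + ∣ R ∣ → a ∈ R → ReachedFrom E a R → ∀ b → Walk E a b
  reach-all fuel R bound a∈R walks b with b ∈? R
  ... | yes b∈R = walks b∈R
  reach-all zero R bound a∈R walks b | no b∉R =
    contradiction (subst (b ∈_) (sym (∣p∣≡n⇒p≡⊤ (≤-antisym (∣p∣≤n R) bound))) ∈⊤) b∉R
  reach-all (suc fuel) R bound a∈R walks b | no b∉R
    with reach-one-more a∈R b∉R walks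
  ... | y , y∉R , walks′ =
    reach-all fuel (R ∪ ⁅ y ⁆) bound′ (p⊆p∪q ⁅ y ⁆ a∈R) walks′ b
    where
    R<R′ : ∣ R ∣ < ∣ R ∪ ⁅ y ⁆ ∣
    R<R′ = p⊂q⇒∣p∣<∣q∣ (p⊆p∪q ⁅ y ⁆ , y , x∈p∪q⁺ (inj₂ (x∈⁅x⁆ y)) , y∉R)
    open ≤-Reasoning
    bound′ : n ≤ fuel + ∣ R ∪ ⁅ y ⁆ ∣
    bound′ = begin
      n                    ≤⟨ bound ⟩
      suc fuel + ∣ R ∣     ≡⟨ +-suc fuel ∣ R ∣ ⟨
      fuel + suc ∣ R ∣     ≤⟨ +-monoʳ-≤ fuel R<R′ ⟩
      fuel + ∣ R ∪ ⁅ y ⁆ ∣ ∎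

crosses-every-cut⇒connected : ∀ {n} {E : Fin n → Fin n → Bool} → CrossesEveryCut E → Connected E
crosses-every-cut⇒connected {n} {E} crosses a =
  reach-all a crosses n ⁅ a ⁆ (m≤m+n n _) (x∈⁅x⁆ a) from-a
  where
  from-a : ReachedFrom E a ⁅ a ⁆
  from-a x∈⁅a⁆ with x∈⁅y⁆⇒x≡y a x∈⁅a⁆
  ... | refl = here

edgeless-walk : ∀ {n} {E : Fin n → Fin n → Bool} → (∀ a b → E a b ≡ false) →
                ∀ {a b} → Walk E a b → a ≡ b
edgeless-walk no-edges here                  = refl
edgeless-walk no-edges (step {a} {c} Eac _) =
  contradiction (trans (sym (no-edges a c)) Eac) λ ()

symDiff-self : ∀ {n} {H : Graph n} {G₁ G₂ : SpanningSubgraph H} → SameSubgraph G₁ G₂ →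
               ∀ a b → symDiff G₁ G₂ a b ≡ false
symDiff-self {G₂ = G₂} same a b =
  trans (cong (_xor edge G₂ a b) (same a b)) (xor-same (edge G₂ a b))

module _ {n r} (H : Graph n) (v : Fin n → Fin n → Z2Vec r) (v-sym : ∀ a b → v a b ≡ v b a) where

  dual-subgraph : Z2Vec r → SpanningSubgraph H
  dual-subgraph w = record
    { edge = λ a b → adj H a b ∧ dot w (v a b)
    ; esym = λ a b → cong₂ (λ e u → e ∧ dot w u) (Graph.sym H a b) (v-sym a b)
    ; inH  = λ _ _ → ∧-true⇒left
    }

  symDiff-dual-subgraph : ∀ x y a b →
    symDiff (dual-subgraph x) (dual-subgraph y) a b ≡ adj H a b ∧ (dot x (v a b) xor dot y (v a b))
  symDiff-dual-subgraph x y a b = sym (∧-distribˡ-xor (adj H a b) (dot x (v a b)) (dot y (v a b)))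

  symDiff-dual-subgraph-connected :
    (∀ (S : Fin n → Bool) → ProperNonempty S → Spans (CutVector H v S)) →
    ∀ {x y} → x ≢ y → Connected (symDiff (dual-subgraph x) (dual-subgraph y))
  symDiff-dual-subgraph-connected spans {x} {y} x≢y = crosses-every-cut⇒connected crosses
    where
    crosses : CrossesEveryCut (symDiff (dual-subgraph x) (dual-subgraph y))
    crosses S S-proper with dot-separates x≢y
    ... | u , x·u≢y·u
      with span-nonzero⇒generator-nonzero (xor-linear (dot-linear x) (dot-linear y))
             (spans S S-proper u) (≢⇒xor≡true x·u≢y·u)
    ... | _ , (a , b , Hab , Sa , Sb , refl) , separated =
      a , b , Sa , Sb , trans (symDiff-dual-subgraph x y a b) (cong₂ _∧_ Hab separated)

lemma2p1 : (n r : ℕ) → 2 ≤ n → (H : Graph n) →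
    (v : Fin n → Fin n → Z2Vec r) → (∀ a b → v a b ≡ v b a) →
    (∀ (S : Fin n → Bool) → ProperNonempty S → Spans (CutVector H v S)) →
    mAtLeast H (2 ^ r)
lemma2p1 (suc (suc _)) r (s≤s (s≤s _)) H v v-sym spans = G , code
  where
  G : Fin (2 ^ r) → SpanningSubgraph H
  G = dual-subgraph H v v-sym ∘ bits r

  code : ConnectivityCode H (2 ^ r) G
  code i j i≢j = distinct , connected
    where
    connected : Connected (symDiff (G i) (G j))
    connected = symDiff-dual-subgraph-connected H v v-sym spans (i≢j ∘ bits-injective r)

    distinct : ¬ SameSubgraph (G i) (G j)
    distinct same
      with edgeless-walk (symDiff-self {G₁ = G i} {G₂ = G j} same) (connected zero (suc zero))
    ... | ()
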